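{- There exists an amicable orthogonal design $AOD\big(2^9;\ 2^6_{(8)};\ 2^6_{(8)}\big)$, i.e. square matrices $C$ and $D$ of order $2^9$, with entries of $C$ in $\{0,\pm x_1,\ldots,\pm x_8\}$ and entries of $D$ in $\{0,\pm y_1,\ldots,\pm y_8\}$, such that $CC^{\rm T}=\big(2^6\sum_{i=1}^8x_i^2\big)I_{2^9}$, $DD^{\rm T}=\big(2^6\sum_{i=1}^8y_i^2\big)I_{2^9}$ and $CD^{\rm T}=DC^{\rm T}$.
   Context: $x_1,\ldots,x_8,y_1,\ldots,y_8$ are distinct commuting variables. The notation $u_{(k)}$ means $u$ repeated $k$ times. An amicable orthogonal design $AOD(m;\ c_1,\ldots,c_k;\ d_1,\ldots,d_\ell)$ is a pair $(C;D)$ of orthogonal designs of order $m$ and types $(c_1,\ldots,c_k)$, $(d_1,\ldots,d_\ell)$ in disjoint sets of variables with $CD^{\rm T}=DC^{\rm T}$. -}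

module Defs where

open import Level using (0ℓ)
open import Data.Nat using (ℕ; zero; suc; _^_)
open import Data.Fin using (Fin; _≟_)
import Data.Fin as Fin
open import Data.Bool using (if_then_else_)
open import Relation.Nullary.Decidable using (⌊_⌋)
open import Data.Product using (Σ; _×_)
open import Algebra.Bundles using (CommutativeRing)

data Entry (n : ℕ) : Set where
  𝟎   : Entry n
  pos : Fin n → Entry n
  neg : Fin n → Entry n

Design : ℕ → ℕ → Set
Design m n = Fin m → Fin m → Entry n

module _ (R : CommutativeRing 0ℓ 0ℓ) where
  open CommutativeRing R

  ⟦_⟧ : ∀ {n} → Entry n → (Fin n → Carrier) → Carrier
  ⟦ 𝟎 ⟧     v = 0#
  ⟦ pos i ⟧ v = v i
  ⟦ neg i ⟧ v = - v i

  ∑ : (m : ℕ) → (Fin m → Carrier) → Carrier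
  ∑ zero    f = 0#
  ∑ (suc m) f = f Fin.zero + ∑ m (λ k → f (Fin.suc k))

  _·_ : ℕ → Carrier → Carrier
  zero  · a = 0#
  suc k · a = a + k · a

  δ : ∀ {m} → Fin m → Fin m → Carrier → Carrier
  δ r s a = if ⌊ r ≟ s ⌋ then a else 0#

  mulT : ∀ {m n p} → Design m n → (Fin n → Carrier) → Design m p → (Fin p → Carrier)
       → Fin m → Fin m → Carrier
  mulT {m} A u B w r s = ∑ m (λ k → ⟦ A r k ⟧ u * ⟦ B s k ⟧ w)

-- (C ; D) is an AOD(m; c_(n); c_(n)): identities hold as polynomial identities
-- in commuting variables, i.e. under every assignment in every commutative ring.
IsAOD : (m n c : ℕ) → Design m n → Design m n → Set₁
IsAOD m n c C D =
  (R : CommutativeRing 0ℓ 0ℓ) → let open CommutativeRing R in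
  (x y : Fin n → Carrier) →
    ((r s : Fin m) → mulT R C x C x r s ≈ δ R r s (_·_ R c (∑ R n (λ i → x i * x i))))
  × ((r s : Fin m) → mulT R D y D y r s ≈ δ R r s (_·_ R c (∑ R n (λ i → y i * y i))))
  × ((r s : Fin m) → mulT R C x D y r s ≈ mulT R D y C x r s)

-- Both designs have the form Σⱼ xⱼ Aⱼ with each Aⱼ a Kronecker product of nine 2×2 (0,±1)-matrices:
-- three signed permutation matrices (𝟙, Z, X, W), whose permutations differ for different j so that
-- the Aⱼ have disjoint supports, followed by six Hadamard matrices, which give Aⱼ Aⱼᵀ = 2⁶ I.
-- By the mixed-product property Aᵢ Bⱼᵀ = ⊗ₜ Xₜ Yₜᵀ, so relations Xₜ Yₜᵀ = ±Yₜ Xₜᵀ between the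
-- factors multiply up to Aᵢ Bⱼᵀ = ±Bⱼ Aᵢᵀ. Within each family the sign is −1 whenever i ≠ k, so
-- the cross terms of C Cᵀ = Σᵢₖ xᵢ xₖ Aᵢ Aₖᵀ cancel in pairs; between the families it is +1,
-- which gives C Dᵀ = D Cᵀ. The 2×2 relations are decided by computing over ℤ and then
-- transported to an arbitrary commutative ring.

module Submission where

open import Defs
open import Data.Nat using (_^_)
open import Data.Product using (Σ)
open import Level using (0ℓ)
open import Function using (_∘_)
open import Data.Nat as ℕ using (ℕ; zero; suc)
open import Data.Fin using (Fin; zero; suc; _↑ˡ_; _↑ʳ_; combine; quotient; remainder; _≟_)
open import Data.Fin.Patterns using (0F; 1F)
open import Data.Fin.Properties using (remQuot-combine; combine-remQuot; suc-injective; all?)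
open import Data.Integer as ℤ using (ℤ; +_; -[1+_])
import Data.Integer.Properties as ℤ
open import Data.Sign as Sign using (Sign)
import Data.Sign.Properties as Sign
open import Data.Bool using (true; false)
open import Data.Maybe as Maybe using (Maybe; just; nothing)
import Data.Maybe.Properties as Maybe
open import Data.Vec as Vec using (Vec; []; _∷_)
open import Data.Vec.Relation.Unary.Any using (Any; here; there; any?)
open import Data.Product using (_,_; uncurry)
open import Data.Sum using (_⊎_; inj₁; inj₂)
open import Relation.Binary.PropositionalEquality using (_≡_; _≢_; refl; cong; cong₂)
import Relation.Binary.PropositionalEquality as ≡
open import Relation.Nullary using (Dec; yes; no; ¬?; contradiction)
open import Relation.Nullary.Decidable using (⌊_⌋; from-yes; map′; _×-dec_; _⊎-dec_; _→-dec_)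
open import Algebra.Bundles using (CommutativeRing)

Matrix : Set → ℕ → Set
Matrix A m = Fin m → Fin m → A

module Kronecker {A : Set} (_∙_ : A → A → A) (ε : A) where

  infixr 7 _⊗_

  _⊗_ : ∀ {m n} → Matrix A m → Matrix A n → Matrix A (m ℕ.* n)
  _⊗_ {m} {n} M N r s = M (quotient {m} n r) (quotient {m} n s) ∙ N (remainder {m} n r) (remainder {m} n s)

  ⨂ : ∀ {t} → Vec (Matrix A 2) t → Matrix A (2 ^ t)
  ⨂ []       _ _ = ε
  ⨂ (X ∷ Xs)     = X ⊗ ⨂ Xs

  ⊗-combineʳ : ∀ {m n} (M : Matrix A m) (N : Matrix A n) r i j →
               (M ⊗ N) r (combine i j) ≡ M (quotient {m} n r) i ∙ N (remainder {m} n r) j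
  ⊗-combineʳ {m} {n} M N r i j =
    cong (λ (i′ , j′) → M (quotient {m} n r) i′ ∙ N (remainder {m} n r) j′) (remQuot-combine i j)

quotient-remainder-injective : ∀ {m n} {r s : Fin (m ℕ.* n)} →
  quotient {m} n r ≡ quotient {m} n s → remainder {m} n r ≡ remainder {m} n s → r ≡ s
quotient-remainder-injective {m} {n} {r} {s} q≡ r≡ =
  ≡.trans (≡.sym (combine-remQuot {m} n r)) (≡.trans (cong₂ combine q≡ r≡) (combine-remQuot {m} n s))

S₀ : Set
S₀ = Maybe Sign

0ₛ +ₛ -ₛ : S₀
0ₛ = nothing
+ₛ = just Sign.+
-ₛ = just Sign.-

infixl 7 _*₀_
_*₀_ : S₀ → S₀ → S₀
_*₀_ = Maybe.zipWith Sign._*_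

*₀-zeroʳ : ∀ p → p *₀ 0ₛ ≡ 0ₛ
*₀-zeroʳ nothing  = refl
*₀-zeroʳ (just _) = refl

_≟₀_ : (p q : S₀) → Dec (p ≡ q)
_≟₀_ = Maybe.≡-dec Sign._≟_

open Kronecker _*₀_ +ₛ

M₂ : Set
M₂ = Matrix S₀ 2

Disjoint : ∀ {m} → Matrix S₀ m → Matrix S₀ m → Set
Disjoint M N = ∀ r s → M r s ≡ 0ₛ ⊎ N r s ≡ 0ₛ

PairwiseDisjoint : ∀ {m n} → (Fin n → Matrix S₀ m) → Set
PairwiseDisjoint A = ∀ {i j} → i ≢ j → Disjoint (A i) (A j)

disjoint? : (M N : M₂) → Dec (Disjoint M N)
disjoint? M N = all? λ r → all? λ s → (M r s ≟₀ 0ₛ) ⊎-dec (N r s ≟₀ 0ₛ)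

⊗-disjointˡ : ∀ {m n} {M M′ : Matrix S₀ m} {N N′ : Matrix S₀ n} →
              Disjoint M M′ → Disjoint (M ⊗ N) (M′ ⊗ N′)
⊗-disjointˡ {m} {n} {N = N} {N′} d r s with d (quotient {m} n r) (quotient {m} n s)
... | inj₁ e = inj₁ (cong (_*₀ N (remainder {m} n r) (remainder {m} n s)) e)
... | inj₂ e = inj₂ (cong (_*₀ N′ (remainder {m} n r) (remainder {m} n s)) e)

⊗-disjointʳ : ∀ {m n} {M M′ : Matrix S₀ m} {N N′ : Matrix S₀ n} →
              Disjoint N N′ → Disjoint (M ⊗ N) (M′ ⊗ N′)
⊗-disjointʳ {m} {n} {M} {M′} d r s with d (remainder {m} n r) (remainder {m} n s)
... | inj₁ e = inj₁ (≡.trans (cong (M (quotient {m} n r) (quotient {m} n s) *₀_) e) (*₀-zeroʳ _))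
... | inj₂ e = inj₂ (≡.trans (cong (M′ (quotient {m} n r) (quotient {m} n s) *₀_) e) (*₀-zeroʳ _))

⨂-disjoint : ∀ {t} (Xs Ys : Vec M₂ t) → Any (uncurry Disjoint) (Vec.zip Xs Ys) → Disjoint (⨂ Xs) (⨂ Ys)
⨂-disjoint (X ∷ Xs) (Y ∷ Ys) (here d)  = ⊗-disjointˡ {N = ⨂ Xs} {⨂ Ys} d
⨂-disjoint (X ∷ Xs) (Y ∷ Ys) (there a) = ⊗-disjointʳ {M = X} {Y} (⨂-disjoint Xs Ys a)

module Signed (R : CommutativeRing 0ℓ 0ℓ) where
  open CommutativeRing R

  infixr 8 _◃_
  _◃_ : Sign → Carrier → Carrier
  Sign.+ ◃ a = a
  Sign.- ◃ a = - a

  ⟦_⟧₀ : S₀ → Carrier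
  ⟦ nothing ⟧₀ = 0#
  ⟦ just s ⟧₀  = s ◃ 1#

ℤ-ring : CommutativeRing 0ℓ 0ℓ
ℤ-ring = ℤ.+-*-commutativeRing

open Signed ℤ-ring using () renaming (_◃_ to _◃ℤ_; ⟦_⟧₀ to toℤ)

gramℤ : M₂ → M₂ → Matrix ℤ 2
gramℤ X Y a b = toℤ (X a 0F *₀ Y b 0F) ℤ.+ toℤ (X a 1F *₀ Y b 1F)

_≐?_ : (G H : Matrix ℤ 2) → Dec (∀ a b → G a b ≡ H a b)
G ≐? H = all? λ a → all? λ b → G a b ℤ.≟ H a b

amicability : M₂ → M₂ → Maybe Sign
amicability X Y with gramℤ X Y ≐? (λ a b → gramℤ Y X a b) | gramℤ X Y ≐? (λ a b → ℤ.- gramℤ Y X a b)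
... | yes _ | _     = just Sign.+
... | no _  | yes _ = just Sign.-
... | no _  | no _  = nothing

amicability-gramℤ : ∀ X Y {ε} → amicability X Y ≡ just ε → ∀ a b → gramℤ X Y a b ≡ ε ◃ℤ gramℤ Y X a b
amicability-gramℤ X Y eq with gramℤ X Y ≐? (λ a b → gramℤ Y X a b) | gramℤ X Y ≐? (λ a b → ℤ.- gramℤ Y X a b)
amicability-gramℤ X Y refl | yes p | _     = p
amicability-gramℤ X Y refl | no _  | yes p = p

weight : M₂ → Maybe ℕ
weight X with gramℤ X X ≐? (λ a b → δ ℤ-ring a b (+ ℤ.∣ gramℤ X X 0F 0F ∣))
... | yes _ = just ℤ.∣ gramℤ X X 0F 0F ∣
... | no _  = nothing

weight-gramℤ : ∀ X {c} → weight X ≡ just c → ∀ a b → gramℤ X X a b ≡ δ ℤ-ring a b (+ c)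
weight-gramℤ X eq with gramℤ X X ≐? (λ a b → δ ℤ-ring a b (+ ℤ.∣ gramℤ X X 0F 0F ∣))
weight-gramℤ X refl | yes p = p

⨂-amicability : ∀ {t} → Vec M₂ t → Vec M₂ t → Maybe Sign
⨂-amicability []       []       = just Sign.+
⨂-amicability (X ∷ Xs) (Y ∷ Ys) = Maybe.zipWith Sign._*_ (amicability X Y) (⨂-amicability Xs Ys)

⨂-weight : ∀ {t} → Vec M₂ t → Maybe ℕ
⨂-weight []       = just 1
⨂-weight (X ∷ Xs) = Maybe.zipWith ℕ._*_ (weight X) (⨂-weight Xs)

entry : ∀ {n} → Fin n → Sign → Entry n
entry j Sign.+ = pos j
entry j Sign.- = neg j

raise : ∀ {n} → Entry n → Entry (suc n)
raise 𝟎       = 𝟎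
raise (pos i) = pos (suc i)
raise (neg i) = neg (suc i)

-- Σⱼ xⱼ Aⱼ, provided the Aⱼ have disjoint supports (⟦design⟧).
design : ∀ {m n} → (Fin n → Matrix S₀ m) → Design m n
design {n = zero}  A r k = 𝟎
design {n = suc n} A r k with A zero r k
... | nothing = raise (design (A ∘ suc) r k)
... | just s  = entry zero s

module _ (R : CommutativeRing 0ℓ 0ℓ) where
  open CommutativeRing R hiding (zero) renaming (refl to ≈-refl)
  open import Algebra.Properties.Ring ring using (-‿involutive; -0#≈0#; -‿+-comm; -‿distribˡ-*; -‿distribʳ-*)
  open import Algebra.Properties.Semiring.Sum semiring using (sum; sum-syntax; ∑-comm; ∑-distrib-+; *-distribˡ-sum; *-distribʳ-sum; sum-cong-≋; sum-replicate-zero)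
  open import Algebra.Properties.Semiring.Mult semiring using (_×_; ×1-homo-*; ×-assoc-*; ×-congʳ)
  open import Algebra.Properties.CommutativeSemigroup *-commutativeSemigroup using (interchange)
  open import Relation.Binary.Reasoning.Setoid setoid
  open Signed R
  open Kronecker _*_ 1# using () renaming (_⊗_ to _⊗ᴿ_)

  ◃-cong : ∀ s {a b} → a ≈ b → s ◃ a ≈ s ◃ b
  ◃-cong Sign.+ e = e
  ◃-cong Sign.- e = -‿cong e

  ◃-*-◃ : ∀ s t a b → (s ◃ a) * (t ◃ b) ≈ (s Sign.* t) ◃ (a * b)
  ◃-*-◃ Sign.+ Sign.+ a b = ≈-refl
  ◃-*-◃ Sign.+ Sign.- a b = sym (-‿distribʳ-* a b)
  ◃-*-◃ Sign.- Sign.+ a b = sym (-‿distribˡ-* a b)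
  ◃-*-◃ Sign.- Sign.- a b = begin
    - a * - b     ≈⟨ -‿distribˡ-* a (- b) ⟨
    - (a * - b)   ≈⟨ -‿cong (-‿distribʳ-* a b) ⟨
    - - (a * b)   ≈⟨ -‿involutive (a * b) ⟩
    a * b         ∎

  ⟦*₀⟧ : ∀ p q → ⟦ p *₀ q ⟧₀ ≈ ⟦ p ⟧₀ * ⟦ q ⟧₀
  ⟦*₀⟧ nothing  q        = sym (zeroˡ ⟦ q ⟧₀)
  ⟦*₀⟧ (just s) nothing  = sym (zeroʳ (s ◃ 1#))
  ⟦*₀⟧ (just s) (just t) = sym (trans (◃-*-◃ s t 1# 1#) (◃-cong (s Sign.* t) (*-identityˡ 1#)))

  ∑≡sum : ∀ m (f : Fin m → Carrier) → ∑ R m f ≡ sum f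
  ∑≡sum zero    f = refl
  ∑≡sum (suc m) f = cong (λ z → f zero + z) (∑≡sum m (f ∘ suc))

  sum-↑ : ∀ m {n} (f : Fin (m ℕ.+ n) → Carrier) → sum f ≈ sum (f ∘ (_↑ˡ n)) + sum (f ∘ (m ↑ʳ_))
  sum-↑ zero    f = sym (+-identityˡ _)
  sum-↑ (suc m) f = trans (+-congˡ (sum-↑ m (f ∘ suc))) (sym (+-assoc _ _ _))

  sum-combine : ∀ m {n} (f : Fin (m ℕ.* n) → Carrier) → sum f ≈ ∑[ i < m ] ∑[ j < n ] f (combine i j)
  sum-combine zero        f = ≈-refl
  sum-combine (suc m) {n} f = trans (sum-↑ n f) (+-congˡ (sum-combine m (f ∘ (n ↑ʳ_))))

  sum-*-sum : ∀ {m n} (f : Fin m → Carrier) (g : Fin n → Carrier) → sum f * sum g ≈ ∑[ i < m ] ∑[ j < n ] (f i * g j)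
  sum-*-sum f g = trans (*-distribʳ-sum (sum g) f) (sum-cong-≋ λ i → *-distribˡ-sum (f i) g)

  sum-antisymmetric : ∀ {n} (M : Matrix Carrier n) → (∀ {i k} → i ≢ k → M i k + M k i ≈ 0#) →
                      ∑[ i < n ] ∑[ k < n ] M i k ≈ ∑[ i < n ] M i i
  sum-antisymmetric {zero}  M anti = ≈-refl
  sum-antisymmetric {suc n} M anti = begin
    (M₀₀ + row) + ∑[ i < n ] (M (suc i) zero + ∑[ k < n ] M (suc i) (suc k))
      ≈⟨ +-congˡ (∑-distrib-+ (λ i → M (suc i) zero) _) ⟩
    (M₀₀ + row) + (column + rest)
      ≈⟨ +-assoc M₀₀ row (column + rest) ⟩
    M₀₀ + (row + (column + rest))
      ≈⟨ +-congˡ (+-assoc row column rest) ⟨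
    M₀₀ + ((row + column) + rest)
      ≈⟨ +-congˡ (+-congʳ row+column≈0) ⟩
    M₀₀ + (0# + rest)
      ≈⟨ +-congˡ (+-identityˡ rest) ⟩
    M₀₀ + rest
      ≈⟨ +-congˡ (sum-antisymmetric (λ i k → M (suc i) (suc k)) (λ i≢k → anti (i≢k ∘ suc-injective))) ⟩
    M₀₀ + ∑[ i < n ] M (suc i) (suc i) ∎
    where
    M₀₀ = M zero zero
    row = ∑[ k < n ] M zero (suc k)
    column = ∑[ i < n ] M (suc i) zero
    rest = ∑[ i < n ] ∑[ k < n ] M (suc i) (suc k)
    row+column≈0 : row + column ≈ 0#
    row+column≈0 = begin
      row + column                               ≈⟨ ∑-distrib-+ (λ k → M zero (suc k)) (λ k → M (suc k) zero) ⟨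
      ∑[ k < n ] (M zero (suc k) + M (suc k) zero) ≈⟨ sum-cong-≋ (λ k → anti {zero} {suc k} λ ()) ⟩
      ∑[ k < n ] 0#                              ≈⟨ sum-replicate-zero n ⟩
      0#                                         ∎

  δ-refl : ∀ {m} (r : Fin m) a → δ R r r a ≡ a
  δ-refl r a with r ≟ r
  ... | yes _   = refl
  ... | no r≢r = contradiction refl r≢r

  δ-≢ : ∀ {m} {r s : Fin m} a → r ≢ s → δ R r s a ≡ 0#
  δ-≢ {r = r} {s} a r≢s with r ≟ s
  ... | yes r≡s = contradiction r≡s r≢s
  ... | no _    = refl

  δ-cong : ∀ {m} (r s : Fin m) {a b} → a ≈ b → δ R r s a ≈ δ R r s b
  δ-cong r s a≈b with ⌊ r ≟ s ⌋
  ... | true  = a≈b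
  ... | false = ≈-refl

  δ-⊗ : ∀ {m n} (r s : Fin (m ℕ.* n)) a b →
        δ R (quotient {m} n r) (quotient {m} n s) a * δ R (remainder {m} n r) (remainder {m} n s) b ≈ δ R r s (a * b)
  δ-⊗ {m} {n} r s a b with r ≟ s
  ... | yes refl = *-cong (reflexive (δ-refl _ a)) (reflexive (δ-refl _ b))
  ... | no r≢s with quotient {m} n r ≟ quotient {m} n s
  ...   | no _    = zeroˡ _
  ...   | yes q≡q = trans (*-congˡ (reflexive (δ-≢ b (r≢s ∘ quotient-remainder-injective q≡q)))) (zeroʳ _)

  ·≡× : ∀ c a → _·_ R c a ≡ c × a
  ·≡× zero    a = refl
  ·≡× (suc c) a = cong (λ z → a + z) (·≡× c a)

  *-δ : ∀ {m} (r s : Fin m) c a → a * δ R r s (c × 1#) ≈ δ R r s (_·_ R c a)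
  *-δ r s c a with ⌊ r ≟ s ⌋
  ... | true  = begin
    a * (c × 1#)    ≈⟨ *-comm a (c × 1#) ⟩
    (c × 1#) * a    ≈⟨ ×-assoc-* c 1# a ⟩
    c × (1# * a)    ≈⟨ ×-congʳ c (*-identityˡ a) ⟩
    c × a           ≡⟨ ·≡× c a ⟨
    _·_ R c a       ∎
  ... | false = zeroʳ a

  gram : ∀ {m} → Matrix S₀ m → Matrix S₀ m → Matrix Carrier m
  gram M N r s = sum λ k → ⟦ M r k ⟧₀ * ⟦ N s k ⟧₀

  gram-⊗ : ∀ {m n} (M M′ : Matrix S₀ m) (N N′ : Matrix S₀ n) r s →
           gram (M ⊗ N) (M′ ⊗ N′) r s ≈ (gram M M′ ⊗ᴿ gram N N′) r s
  gram-⊗ {m} {n} M M′ N N′ r s = begin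
    sum (λ k → ⟦ (M ⊗ N) r k ⟧₀ * ⟦ (M′ ⊗ N′) s k ⟧₀)
      ≈⟨ sum-combine m _ ⟩
    ∑[ i < m ] ∑[ j < n ] (⟦ (M ⊗ N) r (combine i j) ⟧₀ * ⟦ (M′ ⊗ N′) s (combine i j) ⟧₀)
      ≈⟨ sum-cong-≋ (λ i → sum-cong-≋ λ j → factorise i j) ⟩
    ∑[ i < m ] ∑[ j < n ] ((⟦ M r₁ i ⟧₀ * ⟦ M′ s₁ i ⟧₀) * (⟦ N r₂ j ⟧₀ * ⟦ N′ s₂ j ⟧₀))
      ≈⟨ sum-*-sum (λ i → ⟦ M r₁ i ⟧₀ * ⟦ M′ s₁ i ⟧₀) (λ j → ⟦ N r₂ j ⟧₀ * ⟦ N′ s₂ j ⟧₀) ⟨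
    gram M M′ r₁ s₁ * gram N N′ r₂ s₂ ∎
    where
    r₁ = quotient {m} n r
    s₁ = quotient {m} n s
    r₂ = remainder {m} n r
    s₂ = remainder {m} n s
    factorise : ∀ i j → ⟦ (M ⊗ N) r (combine i j) ⟧₀ * ⟦ (M′ ⊗ N′) s (combine i j) ⟧₀
                      ≈ (⟦ M r₁ i ⟧₀ * ⟦ M′ s₁ i ⟧₀) * (⟦ N r₂ j ⟧₀ * ⟦ N′ s₂ j ⟧₀)
    factorise i j = begin
      ⟦ (M ⊗ N) r (combine i j) ⟧₀ * ⟦ (M′ ⊗ N′) s (combine i j) ⟧₀
        ≡⟨ cong₂ (λ p q → ⟦ p ⟧₀ * ⟦ q ⟧₀) (⊗-combineʳ M N r i j) (⊗-combineʳ M′ N′ s i j) ⟩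
      ⟦ M r₁ i *₀ N r₂ j ⟧₀ * ⟦ M′ s₁ i *₀ N′ s₂ j ⟧₀
        ≈⟨ *-cong (⟦*₀⟧ (M r₁ i) (N r₂ j)) (⟦*₀⟧ (M′ s₁ i) (N′ s₂ j)) ⟩
      (⟦ M r₁ i ⟧₀ * ⟦ N r₂ j ⟧₀) * (⟦ M′ s₁ i ⟧₀ * ⟦ N′ s₂ j ⟧₀)
        ≈⟨ interchange _ _ _ _ ⟩
      (⟦ M r₁ i ⟧₀ * ⟦ M′ s₁ i ⟧₀) * (⟦ N r₂ j ⟧₀ * ⟦ N′ s₂ j ⟧₀) ∎

  ⟦_⟧ℤ : ℤ → Carrier
  ⟦ + n ⟧ℤ      = n × 1#
  ⟦ -[1+ n ] ⟧ℤ = - (suc n × 1#)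

  ⟦toℤ+toℤ⟧ : ∀ p q → ⟦ toℤ p ℤ.+ toℤ q ⟧ℤ ≈ ⟦ p ⟧₀ + ⟦ q ⟧₀
  ⟦toℤ+toℤ⟧ nothing         nothing         = sym (+-identityˡ 0#)
  ⟦toℤ+toℤ⟧ nothing         (just Sign.+)   = +-comm 1# 0#
  ⟦toℤ+toℤ⟧ nothing         (just Sign.-)   = trans (-‿cong (+-identityʳ 1#)) (sym (+-identityˡ (- 1#)))
  ⟦toℤ+toℤ⟧ (just Sign.+)   nothing         = ≈-refl
  ⟦toℤ+toℤ⟧ (just Sign.-)   nothing         = trans (-‿cong (+-identityʳ 1#)) (sym (+-identityʳ (- 1#)))
  ⟦toℤ+toℤ⟧ (just Sign.+)   (just Sign.+)   = +-congˡ (+-identityʳ 1#)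
  ⟦toℤ+toℤ⟧ (just Sign.+)   (just Sign.-)   = sym (-‿inverseʳ 1#)
  ⟦toℤ+toℤ⟧ (just Sign.-)   (just Sign.+)   = sym (-‿inverseˡ 1#)
  ⟦toℤ+toℤ⟧ (just Sign.-)   (just Sign.-)   = trans (-‿cong (+-congˡ (+-identityʳ 1#))) (sym (-‿+-comm 1# 1#))

  ⟦◃ℤ⟧ : ∀ s z → ⟦ s ◃ℤ z ⟧ℤ ≈ s ◃ ⟦ z ⟧ℤ
  ⟦◃ℤ⟧ Sign.+ z             = ≈-refl
  ⟦◃ℤ⟧ Sign.- (+ zero)      = sym -0#≈0#
  ⟦◃ℤ⟧ Sign.- (+ suc n)     = ≈-refl
  ⟦◃ℤ⟧ Sign.- (-[1+ n ])    = sym (-‿involutive _)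

  ⟦δ⟧ℤ : ∀ {m} (a b : Fin m) c → ⟦ δ ℤ-ring a b (+ c) ⟧ℤ ≡ δ R a b (c × 1#)
  ⟦δ⟧ℤ a b c with ⌊ a ≟ b ⌋
  ... | true  = refl
  ... | false = refl

  gram≈⟦gramℤ⟧ : ∀ X Y a b → gram X Y a b ≈ ⟦ gramℤ X Y a b ⟧ℤ
  gram≈⟦gramℤ⟧ X Y a b = begin
    ⟦ X a 0F ⟧₀ * ⟦ Y b 0F ⟧₀ + (⟦ X a 1F ⟧₀ * ⟦ Y b 1F ⟧₀ + 0#)
      ≈⟨ +-congˡ (+-identityʳ _) ⟩
    ⟦ X a 0F ⟧₀ * ⟦ Y b 0F ⟧₀ + ⟦ X a 1F ⟧₀ * ⟦ Y b 1F ⟧₀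
      ≈⟨ +-cong (⟦*₀⟧ (X a 0F) (Y b 0F)) (⟦*₀⟧ (X a 1F) (Y b 1F)) ⟨
    ⟦ X a 0F *₀ Y b 0F ⟧₀ + ⟦ X a 1F *₀ Y b 1F ⟧₀
      ≈⟨ ⟦toℤ+toℤ⟧ (X a 0F *₀ Y b 0F) (X a 1F *₀ Y b 1F) ⟨
    ⟦ gramℤ X Y a b ⟧ℤ ∎

  amicability-gram : ∀ X Y {ε} → amicability X Y ≡ just ε → ∀ a b → gram X Y a b ≈ ε ◃ gram Y X a b
  amicability-gram X Y {ε} eq a b = begin
    gram X Y a b               ≈⟨ gram≈⟦gramℤ⟧ X Y a b ⟩
    ⟦ gramℤ X Y a b ⟧ℤ          ≡⟨ cong ⟦_⟧ℤ (amicability-gramℤ X Y eq a b) ⟩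
    ⟦ ε ◃ℤ gramℤ Y X a b ⟧ℤ     ≈⟨ ⟦◃ℤ⟧ ε (gramℤ Y X a b) ⟩
    ε ◃ ⟦ gramℤ Y X a b ⟧ℤ      ≈⟨ ◃-cong ε (gram≈⟦gramℤ⟧ Y X a b) ⟨
    ε ◃ gram Y X a b           ∎

  weight-gram : ∀ X {c} → weight X ≡ just c → ∀ a b → gram X X a b ≈ δ R a b (c × 1#)
  weight-gram X {c} eq a b = begin
    gram X X a b                ≈⟨ gram≈⟦gramℤ⟧ X X a b ⟩
    ⟦ gramℤ X X a b ⟧ℤ           ≡⟨ cong ⟦_⟧ℤ (weight-gramℤ X eq a b) ⟩
    ⟦ δ ℤ-ring a b (+ c) ⟧ℤ      ≡⟨ ⟦δ⟧ℤ a b c ⟩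
    δ R a b (c × 1#)            ∎

  ⨂-amicability-gram : ∀ {t} (Xs Ys : Vec M₂ t) {ε} → ⨂-amicability Xs Ys ≡ just ε →
                       ∀ r s → gram (⨂ Xs) (⨂ Ys) r s ≈ ε ◃ gram (⨂ Ys) (⨂ Xs) r s
  ⨂-amicability-gram []       []       refl r s = ≈-refl
  ⨂-amicability-gram (X ∷ Xs) (Y ∷ Ys) eq   r s with amicability X Y in e₁ | ⨂-amicability Xs Ys in e₂
  ... | just ε₁ | just ε₂ with refl ← eq = begin
    gram (X ⊗ ⨂ Xs) (Y ⊗ ⨂ Ys) r s
      ≈⟨ gram-⊗ X Y (⨂ Xs) (⨂ Ys) r s ⟩
    (gram X Y ⊗ᴿ gram (⨂ Xs) (⨂ Ys)) r s
      ≈⟨ *-cong (amicability-gram X Y e₁ _ _) (⨂-amicability-gram Xs Ys e₂ _ _) ⟩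
    (ε₁ ◃ _) * (ε₂ ◃ _)
      ≈⟨ ◃-*-◃ ε₁ ε₂ _ _ ⟩
    (ε₁ Sign.* ε₂) ◃ (gram Y X ⊗ᴿ gram (⨂ Ys) (⨂ Xs)) r s
      ≈⟨ ◃-cong (ε₁ Sign.* ε₂) (gram-⊗ Y X (⨂ Ys) (⨂ Xs) r s) ⟨
    (ε₁ Sign.* ε₂) ◃ gram (Y ⊗ ⨂ Ys) (X ⊗ ⨂ Xs) r s ∎

  ⨂-weight-gram : ∀ {t} (Xs : Vec M₂ t) {c} → ⨂-weight Xs ≡ just c → ∀ r s → gram (⨂ Xs) (⨂ Xs) r s ≈ δ R r s (c × 1#)
  ⨂-weight-gram []       refl zero zero = +-congʳ (*-identityˡ 1#)
  ⨂-weight-gram (X ∷ Xs) eq   r    s    with weight X in e₁ | ⨂-weight Xs in e₂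
  ... | just c₁ | just c₂ with refl ← eq = begin
    gram (X ⊗ ⨂ Xs) (X ⊗ ⨂ Xs) r s
      ≈⟨ gram-⊗ X X (⨂ Xs) (⨂ Xs) r s ⟩
    (gram X X ⊗ᴿ gram (⨂ Xs) (⨂ Xs)) r s
      ≈⟨ *-cong (weight-gram X e₁ _ _) (⨂-weight-gram Xs e₂ _ _) ⟩
    _ * _
      ≈⟨ δ-⊗ r s (c₁ × 1#) (c₂ × 1#) ⟩
    δ R r s ((c₁ × 1#) * (c₂ × 1#))
      ≈⟨ δ-cong r s (×1-homo-* c₁ c₂) ⟨
    δ R r s ((c₁ ℕ.* c₂) × 1#) ∎

  ⟦entry⟧ : ∀ {n} (j : Fin n) s x → ⟦_⟧ R (entry j s) x ≈ x j * ⟦ just s ⟧₀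
  ⟦entry⟧ j Sign.+ x = sym (*-identityʳ (x j))
  ⟦entry⟧ j Sign.- x = trans (-‿cong (sym (*-identityʳ (x j)))) (-‿distribʳ-* (x j) 1#)

  ⟦raise⟧ : ∀ {n} (e : Entry n) x → ⟦_⟧ R (raise e) x ≡ ⟦_⟧ R e (x ∘ suc)
  ⟦raise⟧ 𝟎       x = refl
  ⟦raise⟧ (pos i) x = refl
  ⟦raise⟧ (neg i) x = refl

  ⟦design⟧ : ∀ {m n} (A : Fin n → Matrix S₀ m) → PairwiseDisjoint A →
             ∀ x r k → ⟦_⟧ R (design A r k) x ≈ ∑[ j < n ] (x j * ⟦ A j r k ⟧₀)
  ⟦design⟧ {n = zero}  A disj x r k = ≈-refl
  ⟦design⟧ {n = suc n} A disj x r k with A zero r k in eq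
  ... | nothing = begin
    ⟦_⟧ R (raise (design (A ∘ suc) r k)) x                  ≡⟨ ⟦raise⟧ (design (A ∘ suc) r k) x ⟩
    ⟦_⟧ R (design (A ∘ suc) r k) (x ∘ suc)                  ≈⟨ ⟦design⟧ (A ∘ suc) (λ i≢j → disj (i≢j ∘ suc-injective)) (x ∘ suc) r k ⟩
    ∑[ j < n ] (x (suc j) * ⟦ A (suc j) r k ⟧₀)             ≈⟨ +-identityˡ _ ⟨
    0# + ∑[ j < n ] (x (suc j) * ⟦ A (suc j) r k ⟧₀)        ≈⟨ +-congʳ (zeroʳ (x zero)) ⟨
    x zero * 0# + ∑[ j < n ] (x (suc j) * ⟦ A (suc j) r k ⟧₀) ∎
  ... | just s = begin
    ⟦_⟧ R (entry zero s) x                                       ≈⟨ ⟦entry⟧ zero s x ⟩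
    x zero * ⟦ just s ⟧₀                                         ≈⟨ +-identityʳ _ ⟨
    x zero * ⟦ just s ⟧₀ + 0#                                    ≈⟨ +-congˡ (sum-replicate-zero n) ⟨
    x zero * ⟦ just s ⟧₀ + ∑[ j < n ] 0#                         ≈⟨ +-congˡ (sum-cong-≋ others) ⟨
    x zero * ⟦ just s ⟧₀ + ∑[ j < n ] (x (suc j) * ⟦ A (suc j) r k ⟧₀) ∎
    where
    others : ∀ j → x (suc j) * ⟦ A (suc j) r k ⟧₀ ≈ 0#
    others j with disj {zero} {suc j} (λ ()) r k
    ... | inj₁ A₀≡0 = contradiction (≡.trans (≡.sym eq) A₀≡0) λ ()
    ... | inj₂ Aⱼ≡0 = trans (*-congˡ (reflexive (cong ⟦_⟧₀ Aⱼ≡0))) (zeroʳ _)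

  mulT-design : ∀ {m n} (A B : Fin n → Matrix S₀ m) → PairwiseDisjoint A → PairwiseDisjoint B → ∀ x y r s →
                mulT R (design A) x (design B) y r s ≈ ∑[ i < n ] ∑[ j < n ] ((x i * y j) * gram (A i) (B j) r s)
  mulT-design {m} {n} A B disjA disjB x y r s = begin
    mulT R (design A) x (design B) y r s
      ≡⟨ ∑≡sum m _ ⟩
    sum (λ k → ⟦_⟧ R (design A r k) x * ⟦_⟧ R (design B s k) y)
      ≈⟨ sum-cong-≋ (λ k → *-cong (⟦design⟧ A disjA x r k) (⟦design⟧ B disjB y s k)) ⟩
    sum (λ k → ∑[ i < n ] (x i * a i k) * ∑[ j < n ] (y j * b j k))
      ≈⟨ sum-cong-≋ (λ k → sum-*-sum (λ i → x i * a i k) (λ j → y j * b j k)) ⟩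
    sum (λ k → ∑[ i < n ] ∑[ j < n ] ((x i * a i k) * (y j * b j k)))
      ≈⟨ ∑-comm (λ k i → ∑[ j < n ] ((x i * a i k) * (y j * b j k))) ⟩
    ∑[ i < n ] sum (λ k → ∑[ j < n ] ((x i * a i k) * (y j * b j k)))
      ≈⟨ sum-cong-≋ (λ i → ∑-comm (λ k j → (x i * a i k) * (y j * b j k))) ⟩
    ∑[ i < n ] ∑[ j < n ] sum (λ k → (x i * a i k) * (y j * b j k))
      ≈⟨ sum-cong-≋ (λ i → sum-cong-≋ λ j → sum-cong-≋ λ k → interchange (x i) (a i k) (y j) (b j k)) ⟩
    ∑[ i < n ] ∑[ j < n ] sum (λ k → (x i * y j) * (a i k * b j k))
      ≈⟨ sum-cong-≋ (λ i → sum-cong-≋ λ j → *-distribˡ-sum (x i * y j) (λ k → a i k * b j k)) ⟨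
    ∑[ i < n ] ∑[ j < n ] ((x i * y j) * gram (A i) (B j) r s) ∎
    where
    a b : Fin n → Fin m → Carrier
    a i k = ⟦ A i r k ⟧₀
    b j k = ⟦ B j s k ⟧₀

  design-orthogonal : ∀ {m n} c (A : Fin n → Matrix S₀ m) → PairwiseDisjoint A →
    (∀ {i k} → i ≢ k → ∀ r s → gram (A i) (A k) r s ≈ - gram (A k) (A i) r s) →
    (∀ i r s → gram (A i) (A i) r s ≈ δ R r s (c × 1#)) →
    ∀ x r s → mulT R (design A) x (design A) x r s ≈ δ R r s (_·_ R c (∑ R n (λ i → x i * x i)))
  design-orthogonal {n = n} c A disj anti diagonal x r s = begin
    mulT R (design A) x (design A) x r s
      ≈⟨ mulT-design A A disj disj x x r s ⟩
    ∑[ i < n ] ∑[ k < n ] ((x i * x k) * G i k)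
      ≈⟨ sum-antisymmetric (λ i k → (x i * x k) * G i k) cancel ⟩
    ∑[ i < n ] ((x i * x i) * G i i)
      ≈⟨ sum-cong-≋ (λ i → *-congˡ (diagonal i r s)) ⟩
    ∑[ i < n ] ((x i * x i) * δ R r s (c × 1#))
      ≈⟨ *-distribʳ-sum (δ R r s (c × 1#)) (λ i → x i * x i) ⟨
    sum (λ i → x i * x i) * δ R r s (c × 1#)
      ≈⟨ *-δ r s c _ ⟩
    δ R r s (_·_ R c (sum (λ i → x i * x i)))
      ≡⟨ cong (λ S → δ R r s (_·_ R c S)) (∑≡sum n _) ⟨
    δ R r s (_·_ R c (∑ R n (λ i → x i * x i))) ∎
    where
    G : Matrix Carrier n
    G i k = gram (A i) (A k) r s
    cancel : ∀ {i k} → i ≢ k → (x i * x k) * G i k + (x k * x i) * G k i ≈ 0#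
    cancel {i} {k} i≢k = begin
      (x i * x k) * G i k + (x k * x i) * G k i   ≈⟨ +-congˡ (*-congʳ (*-comm (x k) (x i))) ⟩
      (x i * x k) * G i k + (x i * x k) * G k i   ≈⟨ distribˡ (x i * x k) (G i k) (G k i) ⟨
      (x i * x k) * (G i k + G k i)               ≈⟨ *-congˡ (+-congʳ (anti i≢k r s)) ⟩
      (x i * x k) * (- G k i + G k i)             ≈⟨ *-congˡ (-‿inverseˡ (G k i)) ⟩
      (x i * x k) * 0#                            ≈⟨ zeroʳ (x i * x k) ⟩
      0#                                          ∎

  design-amicable : ∀ {m n} (A B : Fin n → Matrix S₀ m) → PairwiseDisjoint A → PairwiseDisjoint B →
    (∀ i j r s → gram (A i) (B j) r s ≈ gram (B j) (A i) r s) →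
    ∀ x y r s → mulT R (design A) x (design B) y r s ≈ mulT R (design B) y (design A) x r s
  design-amicable {n = n} A B disjA disjB amic x y r s = begin
    mulT R (design A) x (design B) y r s
      ≈⟨ mulT-design A B disjA disjB x y r s ⟩
    ∑[ i < n ] ∑[ j < n ] ((x i * y j) * gram (A i) (B j) r s)
      ≈⟨ ∑-comm (λ i j → (x i * y j) * gram (A i) (B j) r s) ⟩
    ∑[ j < n ] ∑[ i < n ] ((x i * y j) * gram (A i) (B j) r s)
      ≈⟨ sum-cong-≋ (λ j → sum-cong-≋ λ i → *-cong (*-comm (x i) (y j)) (amic i j r s)) ⟩
    ∑[ j < n ] ∑[ i < n ] ((y j * x i) * gram (B j) (A i) r s)
      ≈⟨ mulT-design B A disjB disjA y x r s ⟨
    mulT R (design B) y (design A) x r s ∎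

record IsODFamily {n t} (c : ℕ) (Xs : Fin n → Vec M₂ t) : Set where
  field
    disjoint      : ∀ i k → i ≢ k → Any (uncurry Disjoint) (Vec.zip (Xs i) (Xs k))
    anti-amicable : ∀ i k → i ≢ k → ⨂-amicability (Xs i) (Xs k) ≡ just Sign.-
    weights       : ∀ i → ⨂-weight (Xs i) ≡ just c

  pairwise-disjoint : PairwiseDisjoint (⨂ ∘ Xs)
  pairwise-disjoint {i} {k} i≢k = ⨂-disjoint (Xs i) (Xs k) (disjoint i k i≢k)

open IsODFamily

pairwise? : ∀ {n} {P : Fin n → Fin n → Set} → (∀ i k → Dec (P i k)) → Dec (∀ i k → i ≢ k → P i k)
pairwise? P? = all? λ i → all? λ k → ¬? (i ≟ k) →-dec P? i k

isODFamily? : ∀ {n t} c (Xs : Fin n → Vec M₂ t) → Dec (IsODFamily c Xs)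
isODFamily? c Xs = map′ (λ (d , a , w) → record { disjoint = d ; anti-amicable = a ; weights = w })
                        (λ F → disjoint F , anti-amicable F , weights F)
  (   pairwise? (λ i k → any? (uncurry disjoint?) (Vec.zip (Xs i) (Xs k)))
  ×-dec pairwise? (λ i k → Maybe.≡-dec Sign._≟_ (⨂-amicability (Xs i) (Xs k)) (just Sign.-))
  ×-dec all? (λ i → Maybe.≡-dec ℕ._≟_ (⨂-weight (Xs i)) (just c)))

areAmicable? : ∀ {n t} (Xs Ys : Fin n → Vec M₂ t) → Dec (∀ i j → ⨂-amicability (Xs i) (Ys j) ≡ just Sign.+)
areAmicable? Xs Ys = all? λ i → all? λ j → Maybe.≡-dec Sign._≟_ (⨂-amicability (Xs i) (Ys j)) (just Sign.+)

kronecker-AOD : ∀ {n t} c (Xs Ys : Fin n → Vec M₂ t) → IsODFamily c Xs → IsODFamily c Ys →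
                (∀ i j → ⨂-amicability (Xs i) (Ys j) ≡ just Sign.+) →
                IsAOD (2 ^ t) n c (design (⨂ ∘ Xs)) (design (⨂ ∘ Ys))
kronecker-AOD {n} c Xs Ys Xs-family Ys-family amicable R x y =
    orthogonal Xs-family x
  , orthogonal Ys-family y
  , design-amicable R (⨂ ∘ Xs) (⨂ ∘ Ys) (pairwise-disjoint Xs-family) (pairwise-disjoint Ys-family)
      (λ i j → ⨂-amicability-gram R (Xs i) (Ys j) (amicable i j)) x y
  where
  open CommutativeRing R using (Carrier; _≈_; _*_)
  orthogonal : ∀ {Zs} → IsODFamily c Zs → ∀ (z : Fin n → Carrier) r s →
               mulT R (design (⨂ ∘ Zs)) z (design (⨂ ∘ Zs)) z r s ≈ δ R r s (_·_ R c (∑ R n (λ i → z i * z i)))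
  orthogonal {Zs} F = design-orthogonal R c (⨂ ∘ Zs) (pairwise-disjoint F)
    (λ {i} {k} i≢k → ⨂-amicability-gram R (Zs i) (Zs k) (anti-amicable F i k i≢k))
    (λ i → ⨂-weight-gram R (Zs i) (weights F i))

[_,_/_,_] : S₀ → S₀ → S₀ → S₀ → M₂
[ a , b / c , d ] 0F 0F = a
[ a , b / c , d ] 0F 1F = b
[ a , b / c , d ] 1F 0F = c
[ a , b / c , d ] 1F 1F = d

𝟙 Z X W H₀ H₁ H₂ H₃ : M₂
𝟙  = [ +ₛ , 0ₛ / 0ₛ , +ₛ ]
Z  = [ +ₛ , 0ₛ / 0ₛ , -ₛ ]
X  = [ 0ₛ , +ₛ / +ₛ , 0ₛ ]
W  = [ 0ₛ , -ₛ / +ₛ , 0ₛ ]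
H₀ = [ +ₛ , +ₛ / +ₛ , -ₛ ]
H₁ = [ +ₛ , +ₛ / -ₛ , +ₛ ]
H₂ = [ +ₛ , -ₛ / +ₛ , +ₛ ]
H₃ = [ -ₛ , +ₛ / +ₛ , +ₛ ]

C-factors D-factors : Fin 8 → Vec M₂ 9
C-factors = Vec.lookup
  ( (Z ∷ 𝟙 ∷ 𝟙 ∷ H₃ ∷ H₂ ∷ H₂ ∷ H₁ ∷ H₃ ∷ H₂ ∷ [])
  ∷ (𝟙 ∷ Z ∷ W ∷ H₁ ∷ H₁ ∷ H₀ ∷ H₃ ∷ H₀ ∷ H₃ ∷ [])
  ∷ (𝟙 ∷ W ∷ 𝟙 ∷ H₂ ∷ H₂ ∷ H₂ ∷ H₃ ∷ H₀ ∷ H₁ ∷ [])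
  ∷ (Z ∷ X ∷ W ∷ H₃ ∷ H₃ ∷ H₀ ∷ H₁ ∷ H₁ ∷ H₃ ∷ [])
  ∷ (W ∷ Z ∷ 𝟙 ∷ H₁ ∷ H₂ ∷ H₂ ∷ H₂ ∷ H₁ ∷ H₂ ∷ [])
  ∷ (W ∷ Z ∷ W ∷ H₂ ∷ H₂ ∷ H₁ ∷ H₁ ∷ H₁ ∷ H₁ ∷ [])
  ∷ (W ∷ X ∷ Z ∷ H₁ ∷ H₀ ∷ H₂ ∷ H₁ ∷ H₃ ∷ H₁ ∷ [])
  ∷ (X ∷ X ∷ X ∷ H₃ ∷ H₁ ∷ H₂ ∷ H₃ ∷ H₁ ∷ H₁ ∷ [])
  ∷ [])
D-factors = Vec.lookup
  ( (Z ∷ 𝟙 ∷ Z ∷ H₁ ∷ H₀ ∷ H₀ ∷ H₂ ∷ H₀ ∷ H₃ ∷ [])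
  ∷ (Z ∷ 𝟙 ∷ W ∷ H₂ ∷ H₁ ∷ H₂ ∷ H₀ ∷ H₀ ∷ H₁ ∷ [])
  ∷ (𝟙 ∷ X ∷ 𝟙 ∷ H₃ ∷ H₃ ∷ H₀ ∷ H₂ ∷ H₀ ∷ H₃ ∷ [])
  ∷ (Z ∷ X ∷ X ∷ H₂ ∷ H₂ ∷ H₃ ∷ H₂ ∷ H₀ ∷ H₃ ∷ [])
  ∷ (X ∷ 𝟙 ∷ 𝟙 ∷ H₁ ∷ H₀ ∷ H₃ ∷ H₁ ∷ H₁ ∷ H₁ ∷ [])
  ∷ (W ∷ Z ∷ X ∷ H₁ ∷ H₀ ∷ H₃ ∷ H₁ ∷ H₂ ∷ H₃ ∷ [])
  ∷ (X ∷ X ∷ Z ∷ H₃ ∷ H₃ ∷ H₂ ∷ H₂ ∷ H₂ ∷ H₀ ∷ [])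
  ∷ (W ∷ W ∷ W ∷ H₂ ∷ H₂ ∷ H₁ ∷ H₃ ∷ H₃ ∷ H₁ ∷ [])
  ∷ [])

lemma5p2 : Σ (Design (2 ^ 9) 8) λ C → Σ (Design (2 ^ 9) 8) λ D → IsAOD (2 ^ 9) 8 (2 ^ 6) C D
lemma5p2 = design (⨂ ∘ C-factors) , design (⨂ ∘ D-factors) ,
  kronecker-AOD (2 ^ 6) C-factors D-factors
    (from-yes (isODFamily? (2 ^ 6) C-factors))
    (from-yes (isODFamily? (2 ^ 6) D-factors))
    (from-yes (areAmicable? C-factors D-factors))
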